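{- Let $G=(V,E)$ be a finite simple undirected graph. Then $G$ is a proper max-point-tolerance graph if and only if $G$ is a unit max-point-tolerance graph.
   Context: $G$ is a max-point-tolerance graph (MPTG) if each vertex $u$ can be assigned a pair $(I_u,p_u)$, with $I_u$ a closed bounded real interval and $p_u\in I_u$, such that for distinct $u,v$, $uv\in E$ iff $\{p_u,p_v\}\subseteq I_u\cap I_v$. $G$ is a proper MPTG if it has such a representation in which no interval properly contains another, and a unit MPTG if it has such a representation in which all intervals have the same length.
   Formalization: The intervals $I_u$ have rational endpoints and the points $p_u$ are rational, instead of real, in both the proper and the unit representations. -}

module Defs where

open import Data.Nat using (ℕ)
open import Data.Fin using (Fin)
open import Data.Rational using (ℚ; _≤_; _<_; _-_)
open import Data.Product using (_×_; Σ)
open import Data.Sum using (_⊎_)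
open import Data.Empty using (⊥)
open import Relation.Nullary using (¬_)
open import Relation.Binary.PropositionalEquality using (_≡_)
open import Function.Bundles using (_⇔_)

record Graph : Set₁ where
  field
    n      : ℕ
    Adj    : Fin n → Fin n → Set
    sym    : ∀ {u v} → Adj u v → Adj v u
    irrefl : ∀ {u} → ¬ Adj u u

record PointedInterval : Set where
  constructor ⟨_,_,_⟩
  field
    left  : ℚ
    point : ℚ
    right : ℚ

open PointedInterval public

_∈I_ : ℚ → PointedInterval → Set
x ∈I I = (left I ≤ x) × (x ≤ right I)

_∈∩_,_ : ℚ → PointedInterval → PointedInterval → Set
x ∈∩ I , J = (x ∈I I) × (x ∈I J)

-- I properly contains J (as sets of reals/rationals): J ⊆ I and J ≠ I.
-- (Intervals here are nonempty, since they contain their point.)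
ProperlyContains : PointedInterval → PointedInterval → Set
ProperlyContains I J =
  (left I ≤ left J) × (right J ≤ right I) × ((left I < left J) ⊎ (right J < right I))

length : PointedInterval → ℚ
length I = right I - left I

record MPTGRep (G : Graph) : Set where
  open Graph G
  field
    rep      : Fin n → PointedInterval
    pointIn  : ∀ u → point (rep u) ∈I rep u
    adjacent : ∀ u v → ¬ (u ≡ v) →
               Adj u v ⇔ ((point (rep u) ∈∩ rep u , rep v) × (point (rep v) ∈∩ rep u , rep v))

IsProperMPTG : Graph → Set
IsProperMPTG G = Σ (MPTGRep G) λ R →
  ∀ u v → ¬ ProperlyContains (MPTGRep.rep R u) (MPTGRep.rep R v)

IsUnitMPTG : Graph → Set
IsUnitMPTG G = Σ (MPTGRep G) λ R →
  ∀ u v → length (MPTGRep.rep R u) ≡ length (MPTGRep.rep R v)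

module Submission where

-- A properly contained interval is strictly shorter, so unit representations are proper.
-- Conversely, applying a strictly increasing ψ : ℚ → ℚ to every endpoint and point preserves
-- all comparisons, hence the graph and properness.  In a proper representation the left and
-- right endpoints are ordered alike, and a one-point interval [a, a] meets only copies of
-- itself; shifting everything right of a by 1 makes room to replace it by [a, a + 1].  Once
-- no interval is a single point, sweep the intervals [a, b] in order of left endpoint: the
-- intervals already made unit end by c + 1, c the previous left endpoint, so fixing everything
-- below max(a, c + 1) and stretching linearly above it can send b to a + 1 without touching them.

open import Defs
open import Data.Nat using (zero; suc)
open import Data.Fin using (Fin; zero; suc)
open import Data.Rational
  using (ℚ; _≤_; _<_; _-_; _+_; _*_; -_; 1/_; 0ℚ; 1ℚ; Positive; NonZero; positive; _⊓_; _⊔_)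
open import Data.Rational.Properties
open import Data.Rational.Solver using (module +-*-Solver)
open import Data.Product using (_×_; Σ; ∃; _,_; proj₁; proj₂)
import Data.Product as Product
open import Data.Product.Function.NonDependent.Propositional using (_×-⇔_)
open import Data.Sum using (_⊎_; inj₁; inj₂; [_,_]′)
import Data.Sum as Sum
open import Data.Empty using (⊥-elim)
open import Data.List using (List; []; _∷_; allFin)
import Data.List.Sort as Sort
open import Data.List.Relation.Unary.All as All using (All)
open import Data.List.Relation.Unary.AllPairs as AllPairs using (AllPairs)
open import Data.List.Relation.Unary.Linked.Properties using (Linked⇒AllPairs)
open import Data.List.Relation.Unary.Any using (here; there)
open import Data.List.Membership.Propositional using (_∈_)
open import Data.List.Membership.Propositional.Properties using (∈-allFin)
open import Data.List.Relation.Binary.Permutation.Propositional using (↭-sym)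
open import Data.List.Relation.Binary.Permutation.Propositional.Properties using (∈-resp-↭)
open import Function using (_∘_; id)
open import Function.Bundles using (_⇔_; mk⇔; Equivalence)
open import Function.Construct.Composition using (_⇔-∘_)
open import Function.Construct.Symmetry using (⇔-sym)
open import Relation.Binary.Core using (_Preserves_⟶_)
import Relation.Binary.Construct.On as On
open import Relation.Binary.Bundles using (DecTotalOrder)
open import Relation.Binary.Definitions using (tri<; tri≈; tri>)
open import Relation.Nullary using (¬_; Dec; yes; no)
open import Relation.Nullary.Decidable using (_×-dec_)
open import Relation.Binary.PropositionalEquality
open +-*-Solver using (solve; _:=_; _:+_; _:-_; _:*_; con)

<⇒≱ : ∀ {p q : ℚ} → p < q → ¬ q ≤ p
<⇒≱ p<q q≤p = <-irrefl refl (<-≤-trans p<q q≤p)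

≤∧≢⇒< : ∀ {p q : ℚ} → p ≤ q → p ≢ q → p < q
≤∧≢⇒< p≤q p≢q = ≰⇒> λ q≤p → p≢q (≤-antisym p≤q q≤p)

p<p+1 : ∀ p → p < p + 1ℚ
p<p+1 p = subst (_< p + 1ℚ) (+-identityʳ p) (+-monoʳ-< p (positive⁻¹ 1ℚ))

p<q⇒0<q-p : ∀ {p q} → p < q → 0ℚ < q - p
p<q⇒0<q-p {p} {q} p<q = subst (_< q - p) (+-inverseʳ p) (+-monoˡ-< (- p) p<q)

⊔-<-lub : ∀ {p q r} → p < r → q < r → p ⊔ q < r
⊔-<-lub {p} {q} {r} p<r q<r =
  [ (λ p⊔q≡p → subst (_< r) (sym p⊔q≡p) p<r) , (λ p⊔q≡q → subst (_< r) (sym p⊔q≡q) q<r) ]′ (⊔-sel p q)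

∃-lowerBound : ∀ {k} (f : Fin k → ℚ) → ∃ λ m → ∀ i → m ≤ f i
∃-lowerBound {zero} f = 0ℚ , λ ()
∃-lowerBound {suc k} f with ∃-lowerBound (f ∘ suc)
... | m , m≤f = f zero ⊓ m , λ { zero → p⊓q≤p (f zero) m ; (suc i) → ≤-trans (p⊓q≤q (f zero) m) (m≤f i) }

_⋈_ : PointedInterval → PointedInterval → Set
I ⋈ J = (point I ∈∩ I , J) × (point J ∈∩ I , J)

⋈-comm : ∀ {I J} → I ⋈ J ⇔ J ⋈ I
⋈-comm = mk⇔ swap swap
  where
  swap : ∀ {I J} → I ⋈ J → J ⋈ I
  swap ((pI∈I , pI∈J) , (pJ∈I , pJ∈J)) = (pJ∈J , pJ∈I) , (pI∈J , pI∈I)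

⋈-refl : ∀ {I} → point I ∈I I → I ⋈ I
⋈-refl p∈I = (p∈I , p∈I) , (p∈I , p∈I)

Nondegenerate : PointedInterval → Set
Nondegenerate I = left I < right I

Separated : PointedInterval → PointedInterval → Set
Separated I J = right I < left J ⊎ right J < left I

_∈I?_ : ∀ x I → Dec (x ∈I I)
x ∈I? I = (left I ≤? x) ×-dec (x ≤? right I)

pointIn⇒left≤right : ∀ {I} → point I ∈I I → left I ≤ right I
pointIn⇒left≤right (l≤p , p≤r) = ≤-trans l≤p p≤r

collapse : ∀ {I a} → left I ≡ a → point I ≡ a → right I ≡ a → I ≡ ⟨ a , a , a ⟩
collapse {⟨ l , p , r ⟩} refl refl refl = refl

separated⇒¬⋈ : ∀ {I J} → Separated I J → ¬ I ⋈ J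
separated⇒¬⋈ (inj₁ rI<lJ) ((pI∈I , pI∈J) , _) = <⇒≱ rI<lJ (≤-trans (proj₁ pI∈J) (proj₂ pI∈I))
separated⇒¬⋈ (inj₂ rJ<lI) ((pI∈I , pI∈J) , _) = <⇒≱ rJ<lI (≤-trans (proj₁ pI∈I) (proj₂ pI∈J))

separated⇒¬properlyContains : ∀ {I J} → left J ≤ right J → Separated I J → ¬ ProperlyContains I J
separated⇒¬properlyContains lJ≤rJ (inj₁ rI<lJ) (_ , rJ≤rI , _) = <⇒≱ rI<lJ (≤-trans lJ≤rJ rJ≤rI)
separated⇒¬properlyContains lJ≤rJ (inj₂ rJ<lI) (lI≤lJ , _ , _) = <⇒≱ rJ<lI (≤-trans lI≤lJ lJ≤rJ)

properlyContains-irrefl : ∀ {I} → ¬ ProperlyContains I I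
properlyContains-irrefl (_ , _ , inj₁ l<l) = <-irrefl refl l<l
properlyContains-irrefl (_ , _ , inj₂ r<r) = <-irrefl refl r<r

properlyContains⇒length< : ∀ {I J} → ProperlyContains I J → length J < length I
properlyContains⇒length< (lI≤lJ , rJ≤rI , inj₁ lI<lJ) = +-mono-≤-< rJ≤rI (neg-antimono-< lI<lJ)
properlyContains⇒length< (lI≤lJ , rJ≤rI , inj₂ rJ<rI) = +-mono-<-≤ rJ<rI (neg-antimono-≤ lI≤lJ)

length≡1⇒right≡ : ∀ {I} → length I ≡ 1ℚ → right I ≡ left I + 1ℚ
length≡1⇒right≡ {I} len≡1 = begin
  right I                      ≡⟨ solve 2 (λ r l → r := l :+ (r :- l)) refl (right I) (left I) ⟩
  left I + (right I - left I)  ≡⟨ cong (left I +_) len≡1 ⟩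
  left I + 1ℚ                  ∎
  where open ≡-Reasoning

[p+1]-p≡1 : ∀ p → (p + 1ℚ) - p ≡ 1ℚ
[p+1]-p≡1 = solve 1 (λ p → (p :+ con 1ℚ) :- p := con 1ℚ) refl

-- Strictly monotone changes of coordinates

mapInterval : (ℚ → ℚ) → PointedInterval → PointedInterval
mapInterval ψ I = ⟨ ψ (left I) , ψ (point I) , ψ (right I) ⟩

IsProper : {G : Graph} → MPTGRep G → Set
IsProper R = ∀ u v → ¬ ProperlyContains (MPTGRep.rep R u) (MPTGRep.rep R v)

IsNondegenerate : {G : Graph} → MPTGRep G → Set
IsNondegenerate R = ∀ u → Nondegenerate (MPTGRep.rep R u)

module StrictlyMonotone {ψ : ℚ → ℚ} (ψ-mono-< : ψ Preserves _<_ ⟶ _<_) where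

  ψ-mono-≤ : ψ Preserves _≤_ ⟶ _≤_
  ψ-mono-≤ {p} {q} p≤q with <-cmp p q
  ... | tri< p<q _ _ = <⇒≤ (ψ-mono-< p<q)
  ... | tri≈ _ refl _ = ≤-refl
  ... | tri> _ _ q<p = ⊥-elim (<⇒≱ q<p p≤q)

  ψ-cancel-≤ : ∀ {p q} → ψ p ≤ ψ q → p ≤ q
  ψ-cancel-≤ ψp≤ψq = ≮⇒≥ λ q<p → <⇒≱ (ψ-mono-< q<p) ψp≤ψq

  ψ-cancel-< : ∀ {p q} → ψ p < ψ q → p < q
  ψ-cancel-< ψp<ψq = ≰⇒> λ q≤p → <⇒≱ ψp<ψq (ψ-mono-≤ q≤p)

  ∈I-map : ∀ {x I} → ψ x ∈I mapInterval ψ I ⇔ x ∈I I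
  ∈I-map = mk⇔ (Product.map ψ-cancel-≤ ψ-cancel-≤) (Product.map ψ-mono-≤ ψ-mono-≤)

  ⋈-map : ∀ {I J} → mapInterval ψ I ⋈ mapInterval ψ J ⇔ I ⋈ J
  ⋈-map {I} {J} = (∈I-map {point I} {I} ×-⇔ ∈I-map {point I} {J})
              ×-⇔ (∈I-map {point J} {I} ×-⇔ ∈I-map {point J} {J})

  properlyContains-map⁻ : ∀ {I J} → ProperlyContains (mapInterval ψ I) (mapInterval ψ J) →
                          ProperlyContains I J
  properlyContains-map⁻ (l≤l , r≤r , strict) =
    ψ-cancel-≤ l≤l , ψ-cancel-≤ r≤r , Sum.map ψ-cancel-< ψ-cancel-< strict

  mapRep : {G : Graph} → MPTGRep G → MPTGRep G
  mapRep R = record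
    { rep      = mapInterval ψ ∘ rep
    ; pointIn  = λ u → Equivalence.from (∈I-map {I = rep u}) (pointIn u)
    ; adjacent = λ u v u≢v → ⇔-sym ⋈-map ⇔-∘ adjacent u v u≢v
    }
    where open MPTGRep R

  mapRep-proper : {G : Graph} {R : MPTGRep G} → IsProper R → IsProper (mapRep R)
  mapRep-proper {R = R} proper u v = proper u v ∘ properlyContains-map⁻ {rep u} {rep v}
    where open MPTGRep R

  mapRep-nondegenerate : {G : Graph} {R : MPTGRep G} → IsNondegenerate R → IsNondegenerate (mapRep R)
  mapRep-nondegenerate nondegenerate u = ψ-mono-< (nondegenerate u)

module Proper {G : Graph} (R : MPTGRep G) (proper : IsProper R) where
  open MPTGRep R

  left≡⇒right≡ : ∀ {u w} → left (rep u) ≡ left (rep w) → right (rep u) ≡ right (rep w)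
  left≡⇒right≡ {u} {w} lu≡lw with <-cmp (right (rep u)) (right (rep w))
  ... | tri< ru<rw _ _ = ⊥-elim (proper w u (≤-reflexive (sym lu≡lw) , <⇒≤ ru<rw , inj₂ ru<rw))
  ... | tri≈ _ ru≡rw _ = ru≡rw
  ... | tri> _ _ rw<ru = ⊥-elim (proper u w (≤-reflexive lu≡lw , <⇒≤ rw<ru , inj₂ rw<ru))

  left<⇒right< : ∀ {u w} → left (rep u) < left (rep w) → right (rep u) < right (rep w)
  left<⇒right< {u} {w} lu<lw = ≰⇒> λ rw≤ru → proper u w (<⇒≤ lu<lw , rw≤ru , inj₁ lu<lw)

  -- No other interval can reach a one-point interval without properly containing it.
  degenerate⇒isolated : ∀ {u w} → left (rep u) ≡ right (rep u) → left (rep u) ∈I rep w →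
                        rep w ≡ ⟨ left (rep u) , left (rep u) , left (rep u) ⟩
  degenerate⇒isolated {u} {w} lu≡ru (lw≤lu , lu≤rw) = collapse lw≡lu pw≡lu rw≡lu
    where
    lw≡lu : left (rep w) ≡ left (rep u)
    lw≡lu = ≤-antisym lw≤lu (≮⇒≥ λ lw<lu →
              proper w u (lw≤lu , subst (_≤ right (rep w)) lu≡ru lu≤rw , inj₁ lw<lu))
    rw≡lu : right (rep w) ≡ left (rep u)
    rw≡lu = trans (left≡⇒right≡ lw≡lu) (sym lu≡ru)
    pw≡lu : point (rep w) ≡ left (rep u)
    pw≡lu = ≤-antisym (subst (point (rep w) ≤_) rw≡lu (proj₂ (pointIn w)))
                      (subst (_≤ point (rep w)) lw≡lu (proj₁ (pointIn w)))

-- One-point intervals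

jump : ℚ → ℚ → ℚ
jump a x with x ≤? a
... | yes _ = x
... | no _  = x + 1ℚ

jump-≤ : ∀ {a x} → x ≤ a → jump a x ≡ x
jump-≤ {a} {x} x≤a with x ≤? a
... | yes _   = refl
... | no x≰a  = ⊥-elim (x≰a x≤a)

jump-> : ∀ {a x} → a < x → jump a x ≡ x + 1ℚ
jump-> {a} {x} a<x with x ≤? a
... | yes x≤a = ⊥-elim (<⇒≱ a<x x≤a)
... | no _    = refl

jump-mono-< : ∀ {a} → jump a Preserves _<_ ⟶ _<_
jump-mono-< {a} {x} {y} x<y with x ≤? a | y ≤? a
... | yes _   | yes _   = x<y
... | yes _   | no _    = <-trans x<y (p<p+1 y)
... | no x≰a  | yes y≤a = ⊥-elim (<⇒≱ (<-trans (≰⇒> x≰a) x<y) y≤a)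
... | no _    | no _    = +-monoˡ-< 1ℚ x<y

unitAt : ℚ → PointedInterval
unitAt a = ⟨ a , a , a + 1ℚ ⟩

module Opening (a : ℚ) where
  open StrictlyMonotone (jump-mono-< {a})

  jump-separates : ∀ {I} → ¬ a ∈I I → Separated (mapInterval (jump a) I) (unitAt a)
  jump-separates {I} a∉I with a <? left I
  ... | yes a<lI = inj₂ (subst (a + 1ℚ <_) (sym (jump-> a<lI)) (+-monoˡ-< 1ℚ a<lI))
  ... | no a≮lI = inj₁ (subst (_< a) (sym (jump-≤ (<⇒≤ rI<a))) rI<a)
    where
    rI<a : right I < a
    rI<a = ≰⇒> λ a≤rI → a∉I (≮⇒≥ a≮lI , a≤rI)

  openAt : (I : PointedInterval) → Dec (a ∈I I) → PointedInterval
  openAt I (yes _) = unitAt a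
  openAt I (no _)  = mapInterval (jump a) I

  unitAt-pointIn : point (unitAt a) ∈I unitAt a
  unitAt-pointIn = ≤-refl , <⇒≤ (p<p+1 a)

  openAt-pointIn : ∀ {I} → point I ∈I I → (d : Dec (a ∈I I)) → point (openAt I d) ∈I openAt I d
  openAt-pointIn p∈I (yes _) = unitAt-pointIn
  openAt-pointIn {I} p∈I (no _)  = Equivalence.from (∈I-map {I = I}) p∈I

  Isolated : PointedInterval → Set
  Isolated I = a ∈I I → I ≡ ⟨ a , a , a ⟩

  openAt-⋈ : ∀ {I J} → Isolated I → Isolated J → (dI : Dec (a ∈I I)) (dJ : Dec (a ∈I J)) →
             openAt I dI ⋈ openAt J dJ ⇔ I ⋈ J
  openAt-⋈ isoI isoJ (yes a∈I) (yes a∈J) =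
    mk⇔ (λ _ → subst₂ _⋈_ (sym (isoI a∈I)) (sym (isoJ a∈J)) (⋈-refl (≤-refl , ≤-refl)))
        (λ _ → ⋈-refl unitAt-pointIn)
  openAt-⋈ {J = J} isoI _ (yes a∈I) (no a∉J) =
    mk⇔ (⊥-elim ∘ separated⇒¬⋈ {unitAt a} (Sum.swap (jump-separates {J} a∉J)))
        (λ I⋈J → ⊥-elim (a∉J (subst (_∈I J) (cong point (isoI a∈I)) (proj₂ (proj₁ I⋈J)))))
  openAt-⋈ isoI isoJ (no a∉I) (yes a∈J) =
    ⋈-comm ⇔-∘ (openAt-⋈ isoJ isoI (yes a∈J) (no a∉I) ⇔-∘ ⋈-comm)
  openAt-⋈ _ _ (no _) (no _) = ⋈-map

  openAt-proper : ∀ {I J} → point I ∈I I → point J ∈I J → ¬ ProperlyContains I J →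
                  (dI : Dec (a ∈I I)) (dJ : Dec (a ∈I J)) →
                  ¬ ProperlyContains (openAt I dI) (openAt J dJ)
  openAt-proper _ _ _ (yes _) (yes _) = properlyContains-irrefl {unitAt a}
  openAt-proper {J = J} _ pJ∈J _ (yes _) (no a∉J) =
    separated⇒¬properlyContains {unitAt a} {mapInterval (jump a) J}
      (ψ-mono-≤ (pointIn⇒left≤right {J} pJ∈J)) (Sum.swap (jump-separates {J} a∉J))
  openAt-proper {I} _ _ _ (no a∉I) (yes _) =
    separated⇒¬properlyContains {mapInterval (jump a) I} {unitAt a}
      (<⇒≤ (p<p+1 a)) (jump-separates {I} a∉I)
  openAt-proper {I} {J} _ _ ¬I⊃J (no _) (no _) = ¬I⊃J ∘ properlyContains-map⁻ {I} {J}

  openAt-nondegenerate : ∀ {I} → a ∈I I ⊎ Nondegenerate I → (d : Dec (a ∈I I)) →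
                         Nondegenerate (openAt I d)
  openAt-nondegenerate _                    (yes _)  = p<p+1 a
  openAt-nondegenerate (inj₁ a∈I)           (no a∉I) = ⊥-elim (a∉I a∈I)
  openAt-nondegenerate (inj₂ nondegenerate) (no _)   = jump-mono-< nondegenerate

module OpenDegenerate {G : Graph} (R : MPTGRep G) (proper : IsProper R) (u : Fin (Graph.n G))
                      (lu≡ru : left (MPTGRep.rep R u) ≡ right (MPTGRep.rep R u)) where
  open MPTGRep R
  open Proper R proper
  open Opening (left (rep u))

  decide : ∀ w → Dec (left (rep u) ∈I rep w)
  decide w = left (rep u) ∈I? rep w

  opened : MPTGRep G
  opened = record
    { rep      = λ w → openAt (rep w) (decide w)
    ; pointIn  = λ w → openAt-pointIn (pointIn w) (decide w)
    ; adjacent = λ v w v≢w →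
        ⇔-sym (openAt-⋈ (degenerate⇒isolated lu≡ru) (degenerate⇒isolated lu≡ru) (decide v) (decide w))
          ⇔-∘ adjacent v w v≢w
    }

  opened-proper : IsProper opened
  opened-proper v w = openAt-proper (pointIn v) (pointIn w) (proper v w) (decide v) (decide w)

  opened-nondegenerate : ∀ w → left (rep u) ∈I rep w ⊎ Nondegenerate (rep w) →
                         Nondegenerate (MPTGRep.rep opened w)
  opened-nondegenerate w h = openAt-nondegenerate h (decide w)

module _ {G : Graph} where
  open Graph G using (n)
  open MPTGRep

  ∃-nondegenerateAt : (R : MPTGRep G) → IsProper R → (u : Fin n) →
                      Σ (MPTGRep G) λ R′ → IsProper R′
                                         × (∀ w → Nondegenerate (rep R w) → Nondegenerate (rep R′ w))
                                         × Nondegenerate (rep R′ u)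
  ∃-nondegenerateAt R proper u with left (rep R u) <? right (rep R u)
  ... | yes lu<ru = R , proper , (λ _ → id) , lu<ru
  ... | no lu≮ru  =
    opened , opened-proper , (λ w → opened-nondegenerate w ∘ inj₂) , opened-nondegenerate u (inj₁ lu∈Iu)
    where
    lu≡ru : left (rep R u) ≡ right (rep R u)
    lu≡ru = ≤-antisym (pointIn⇒left≤right (pointIn R u)) (≮⇒≥ lu≮ru)
    lu∈Iu : left (rep R u) ∈I rep R u
    lu∈Iu = ≤-refl , ≤-reflexive lu≡ru
    open OpenDegenerate R proper u lu≡ru

  removeDegeneracies : (R : MPTGRep G) → IsProper R → (todo : List (Fin n)) →
                       (∀ w → w ∈ todo ⊎ Nondegenerate (rep R w)) →
                       Σ (MPTGRep G) λ R′ → IsProper R′ × IsNondegenerate R′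
  removeDegeneracies R proper [] settled = R , proper , λ w → [ (λ ()) , id ]′ (settled w)
  removeDegeneracies R proper (u ∷ todo) settled with ∃-nondegenerateAt R proper u
  ... | R′ , proper′ , preserved , nondegenerate-u = removeDegeneracies R′ proper′ todo settled′
    where
    settled′ : ∀ w → w ∈ todo ⊎ Nondegenerate (rep R′ w)
    settled′ w with settled w
    ... | inj₁ (here refl)      = inj₂ nondegenerate-u
    ... | inj₁ (there w∈todo)   = inj₁ w∈todo
    ... | inj₂ nondegenerate-w  = inj₂ (preserved w nondegenerate-w)

-- Stretching

stretch : ℚ → ℚ → ℚ → ℚ
stretch d k x with x ≤? d
... | yes _ = x
... | no _  = d + (x - d) * k

stretch-≤ : ∀ {d k x} → x ≤ d → stretch d k x ≡ x
stretch-≤ {d} {k} {x} x≤d with x ≤? d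
... | yes _   = refl
... | no x≰d  = ⊥-elim (x≰d x≤d)

stretch-> : ∀ {d k x} → d < x → stretch d k x ≡ d + (x - d) * k
stretch-> {d} {k} {x} d<x with x ≤? d
... | yes x≤d = ⊥-elim (<⇒≱ d<x x≤d)
... | no _    = refl

<-stretched : ∀ {d x} k → .{{Positive k}} → d < x → d < d + (x - d) * k
<-stretched {d} {x} k d<x = subst (_< d + (x - d) * k) (+-identityʳ d) (+-monoʳ-< d 0<[x-d]*k)
  where
  0<[x-d]*k : 0ℚ < (x - d) * k
  0<[x-d]*k = subst (_< (x - d) * k) (*-zeroˡ k) (*-monoˡ-<-pos k (p<q⇒0<q-p d<x))

stretch-mono-< : ∀ {d k} → .{{Positive k}} → stretch d k Preserves _<_ ⟶ _<_
stretch-mono-< {d} {k} {x} {y} x<y with x ≤? d | y ≤? d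
... | yes _   | yes _   = x<y
... | yes x≤d | no y≰d  = ≤-<-trans x≤d (<-stretched k (≰⇒> y≰d))
... | no x≰d  | yes y≤d = ⊥-elim (<⇒≱ (<-trans (≰⇒> x≰d) x<y) y≤d)
... | no _    | no _    = +-monoʳ-< d (*-monoˡ-<-pos k (+-monoˡ-< (- d) x<y))

∃-slope : ∀ {d b t} → d < b → d < t → Σ ℚ λ k → Positive k × d + (b - d) * k ≡ t
∃-slope {d} {b} {t} d<b d<t = (t - d) * 1/ (b - d) , pos*pos⇒pos (t - d) (1/ (b - d)) , hits
  where
  instance
    b-d-positive : Positive (b - d)
    b-d-positive = positive (p<q⇒0<q-p d<b)
    t-d-positive : Positive (t - d)
    t-d-positive = positive (p<q⇒0<q-p d<t)
    b-d-nonZero : NonZero (b - d)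
    b-d-nonZero = pos⇒nonZero (b - d)
    1/[b-d]-positive : Positive (1/ (b - d))
    1/[b-d]-positive = 1/pos⇒pos (b - d)
  *-exchange : ∀ x y z → x * (y * z) ≡ y * (x * z)
  *-exchange = solve 3 (λ x y z → x :* (y :* z) := y :* (x :* z)) refl
  open ≡-Reasoning
  hits : d + (b - d) * ((t - d) * 1/ (b - d)) ≡ t
  hits = begin
    d + (b - d) * ((t - d) * 1/ (b - d))  ≡⟨ cong (d +_) (*-exchange (b - d) (t - d) (1/ (b - d))) ⟩
    d + (t - d) * ((b - d) * 1/ (b - d))  ≡⟨ cong (λ e → d + (t - d) * e) (*-inverseʳ (b - d)) ⟩
    d + (t - d) * 1ℚ                      ≡⟨ solve 2 (λ d t → d :+ (t :- d) :* con 1ℚ := t) refl d t ⟩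
    t                                     ∎

-- Sweeping by left endpoints

module Sweep {G : Graph} where
  open Graph G using (n)
  open MPTGRep

  Done : MPTGRep G → ℚ → Fin n → Set
  Done R c w = length (rep R w) ≡ 1ℚ × left (rep R w) ≤ c

  Pending : MPTGRep G → ℚ → List (Fin n) → Fin n → Set
  Pending R c todo w = w ∈ todo × c < left (rep R w) × c + 1ℚ < right (rep R w)

  SortedByLeft : MPTGRep G → List (Fin n) → Set
  SortedByLeft R = AllPairs (λ v w → left (rep R v) ≤ left (rep R w))

  record State (todo : List (Fin n)) : Set where
    field
      R             : MPTGRep G
      proper        : IsProper R
      nondegenerate : IsNondegenerate R
      cursor        : ℚ
      sorted        : SortedByLeft R todo
      classified    : ∀ w → Done R cursor w ⊎ Pending R cursor todo w

  skip : ∀ {u todo} (s : State (u ∷ todo)) → left (rep (State.R s) u) ≤ State.cursor s → State todo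
  skip {todo = todo} s lu≤c = record
    { R = R ; proper = proper ; nondegenerate = nondegenerate ; cursor = cursor
    ; sorted = AllPairs.tail sorted ; classified = classified′ }
    where
    open State s
    classified′ : ∀ w → Done R cursor w ⊎ Pending R cursor todo w
    classified′ w with classified w
    ... | inj₁ done                            = inj₁ done
    ... | inj₂ (here refl , c<lu , _)          = ⊥-elim (<⇒≱ c<lu lu≤c)
    ... | inj₂ (there w∈todo , c<lw , c+1<rw)  = inj₂ (w∈todo , c<lw , c+1<rw)

  module Stretched {u todo} (s : State (u ∷ todo))
                   (c<a : State.cursor s < left (rep (State.R s) u)) where
    open State s
    open Proper R proper

    a b c d : ℚ
    a = left (rep R u)
    b = right (rep R u)
    c = cursor
    d = a ⊔ (c + 1ℚ)

    c+1<b : c + 1ℚ < b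
    c+1<b with classified u
    ... | inj₁ (_ , a≤c)       = ⊥-elim (<⇒≱ c<a a≤c)
    ... | inj₂ (_ , _ , c+1<b) = c+1<b

    d<b : d < b
    d<b = ⊔-<-lub (nondegenerate u) c+1<b

    slope : Σ ℚ λ k → Positive k × d + (b - d) * k ≡ a + 1ℚ
    slope = ∃-slope d<b (⊔-<-lub (p<p+1 a) (+-monoˡ-< 1ℚ c<a))

    ψ : ℚ → ℚ
    ψ = stretch d (proj₁ slope)

    ψ-mono-< : ψ Preserves _<_ ⟶ _<_
    ψ-mono-< = stretch-mono-< {{proj₁ (proj₂ slope)}}

    open StrictlyMonotone ψ-mono-<

    ψa≡a : ψ a ≡ a
    ψa≡a = stretch-≤ (p≤p⊔q a (c + 1ℚ))

    ψb≡a+1 : ψ b ≡ a + 1ℚ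
    ψb≡a+1 = trans (stretch-> d<b) (proj₂ (proj₂ slope))

    done-stays : ∀ {w} → Done R c w → Done (mapRep R) a w
    done-stays {w} (len≡1 , lw≤c) =
      trans (cong₂ _-_ (stretch-≤ rw≤d) (stretch-≤ lw≤d)) len≡1 ,
      subst (_≤ a) (sym (stretch-≤ lw≤d)) (≤-trans lw≤c (<⇒≤ c<a))
      where
      c+1≤d : c + 1ℚ ≤ d
      c+1≤d = p≤q⊔p a (c + 1ℚ)
      lw≤d : left (rep R w) ≤ d
      lw≤d = ≤-trans lw≤c (≤-trans (<⇒≤ (p<p+1 c)) c+1≤d)
      rw≤d : right (rep R w) ≤ d
      rw≤d = subst (_≤ d) (sym (length≡1⇒right≡ {rep R w} len≡1)) (≤-trans (+-monoˡ-≤ 1ℚ lw≤c) c+1≤d)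

    finishes : ∀ {w} → left (rep R w) ≡ a → Done (mapRep R) a w
    finishes {w} lw≡a = trans (cong₂ _-_ ψrw≡a+1 ψlw≡a) ([p+1]-p≡1 a) , ≤-reflexive ψlw≡a
      where
      ψlw≡a : ψ (left (rep R w)) ≡ a
      ψlw≡a = trans (cong ψ lw≡a) ψa≡a
      ψrw≡a+1 : ψ (right (rep R w)) ≡ a + 1ℚ
      ψrw≡a+1 = trans (cong ψ (sym (left≡⇒right≡ (sym lw≡a)))) ψb≡a+1

    stays-pending : ∀ {w} → w ∈ todo → a < left (rep R w) → Pending (mapRep R) a todo w
    stays-pending {w} w∈todo a<lw =
      w∈todo , subst (_< ψ (left (rep R w))) ψa≡a (ψ-mono-< a<lw) ,
      subst (_< ψ (right (rep R w))) ψb≡a+1 (ψ-mono-< (left<⇒right< a<lw))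

    classified′ : ∀ w → Done (mapRep R) a w ⊎ Pending (mapRep R) a todo w
    classified′ w with classified w
    ... | inj₁ done                 = inj₁ (done-stays done)
    ... | inj₂ (here refl , _)      = inj₁ (finishes refl)
    ... | inj₂ (there w∈todo , _) with a ≟ left (rep R w)
    ...   | yes a≡lw = inj₁ (finishes (sym a≡lw))
    ...   | no a≢lw  =
      inj₂ (stays-pending w∈todo (≤∧≢⇒< (All.lookup (AllPairs.head sorted) w∈todo) a≢lw))

    next : State todo
    next = record
      { R = mapRep R ; proper = mapRep-proper {R = R} proper
      ; nondegenerate = mapRep-nondegenerate {R = R} nondegenerate
      ; cursor = a ; sorted = AllPairs.map ψ-mono-≤ (AllPairs.tail sorted) ; classified = classified′ }

  advance : ∀ {u todo} → State (u ∷ todo) → State todo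
  advance {u} s with left (rep (State.R s) u) ≤? State.cursor s
  ... | yes lu≤c = skip s lu≤c
  ... | no lu≰c  = Stretched.next s (≰⇒> lu≰c)

  finish : ∀ todo → State todo → State []
  finish []         s = s
  finish (u ∷ todo) s = finish todo (advance s)

  finished⇒unit : (s : State []) → ∀ w → length (rep (State.R s) w) ≡ 1ℚ
  finished⇒unit s w with State.classified s w
  ... | inj₁ (len≡1 , _) = len≡1
  ... | inj₂ (() , _)

  byLeft : MPTGRep G → DecTotalOrder _ _ _
  byLeft R = On.decTotalOrder ≤-decTotalOrder (λ w → left (rep R w))

  start : (R : MPTGRep G) → IsProper R → IsNondegenerate R → State (Sort.sort (byLeft R) (allFin n))
  start R proper nondegenerate = record
    { R = R ; proper = proper ; nondegenerate = nondegenerate ; cursor = m - 1ℚ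
    ; sorted = Linked⇒AllPairs ≤-trans (Sort.sort-↗ (byLeft R) (allFin n))
    ; classified = λ w → inj₂ (w∈sorted w , c<lw w , c+1<rw w) }
    where
    w∈sorted : ∀ w → w ∈ Sort.sort (byLeft R) (allFin n)
    w∈sorted w = ∈-resp-↭ (↭-sym (Sort.sort-↭ (byLeft R) (allFin n))) (∈-allFin w)
    bound : ∃ λ m → ∀ w → m ≤ left (rep R w)
    bound = ∃-lowerBound (λ w → left (rep R w))
    m : ℚ
    m = proj₁ bound
    c+1≤lw : ∀ w → (m - 1ℚ) + 1ℚ ≤ left (rep R w)
    c+1≤lw w = subst (_≤ _) (sym (solve 1 (λ m → (m :- con 1ℚ) :+ con 1ℚ := m) refl m)) (proj₂ bound w)
    c<lw : ∀ w → m - 1ℚ < left (rep R w)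
    c<lw w = <-≤-trans (p<p+1 (m - 1ℚ)) (c+1≤lw w)
    c+1<rw : ∀ w → (m - 1ℚ) + 1ℚ < right (rep R w)
    c+1<rw w = ≤-<-trans (c+1≤lw w) (nondegenerate w)

proper⇒unit : ∀ {G} → IsProperMPTG G → IsUnitMPTG G
proper⇒unit {G} (R , proper) with removeDegeneracies R proper (allFin (Graph.n G)) (inj₁ ∘ ∈-allFin)
... | R₁ , proper₁ , nondegenerate₁ =
  State.R s , λ u v → trans (finished⇒unit s u) (sym (finished⇒unit s v))
  where
  open Sweep
  s : State []
  s = finish _ (start R₁ proper₁ nondegenerate₁)

unit⇒proper : ∀ {G} → IsUnitMPTG G → IsProperMPTG G
unit⇒proper (R , sameLength) = R , λ u v u⊃v →
  <-irrefl (sameLength v u) (properlyContains⇒length< {MPTGRep.rep R u} {MPTGRep.rep R v} u⊃v)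

proposition3p19 : (G : Graph) → IsProperMPTG G ⇔ IsUnitMPTG G
proposition3p19 G = mk⇔ proper⇒unit unit⇒proper
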